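{- Let $(P,\leq,\cdot)$ be a right posemigroup. Then: (1) for all $a,b,x\in P$, $a\leq b$ implies $a\cdot x\leq b\cdot x$; (2) for all $c,x,y\in P$, if $c\leq x$ and $c\leq y$ then $c\leq x\cdot y$ and $c\leq y\cdot x$. Hence, if $x\cdot y=y\cdot x$, then $x\cdot y$ is the infimum of $\{x,y\}$.
   Context: A right posemigroup is a structure $(P,\leq,\cdot)$ where $(P,\leq)$ is a poset and $\cdot$ is a right-regular band operation on $P$ (associative, with $x\cdot x=x$ and $x\cdot y\cdot x=y\cdot x$) such that for all $x,y$: $x\leq y\iff x\cdot y=x$. -}

module Defs where

open import Level using (Level; suc; _⊔_)
open import Relation.Binary.PropositionalEquality using (_≡_)
open import Relation.Binary.Structures using (IsPartialOrder)
open import Data.Product using (_×_)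
open import Function.Bundles using (_⇔_)

record RightPosemigroup (c ℓ : Level) : Set (suc (c ⊔ ℓ)) where
  infixl 7 _·_
  infix 4 _≤_
  field
    Carrier        : Set c
    _≤_            : Carrier → Carrier → Set ℓ
    _·_            : Carrier → Carrier → Carrier
    isPartialOrder : IsPartialOrder _≡_ _≤_
    assoc          : ∀ x y z → (x · y) · z ≡ x · (y · z)
    idem           : ∀ x → x · x ≡ x
    rightRegular   : ∀ x y → x · y · x ≡ y · x
    ≤⇔·            : ∀ x y → (x ≤ y) ⇔ (x · y ≡ x)

IsInfimum : ∀ {a ℓ} {A : Set a} → (A → A → Set ℓ) → A → A → A → Set (a ⊔ ℓ)
IsInfimum {A = A} _≤_ x y m = (m ≤ x × m ≤ y) × (∀ c → c ≤ x → c ≤ y → c ≤ m)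

{-# OPTIONS --safe #-}
module Submission where

open import Defs
open import Data.Product using (_×_; _,_)
open import Relation.Binary.PropositionalEquality using (_≡_; trans; sym; cong; module ≡-Reasoning)
open import Function.Bundles using (Equivalence)

module RightPosemigroupProperties {c ℓ} (P : RightPosemigroup c ℓ) where

  open RightPosemigroup P
  open ≡-Reasoning

  ≤⇒·≡ : ∀ {x y} → x ≤ y → x · y ≡ x
  ≤⇒·≡ {x} {y} = Equivalence.to (≤⇔· x y)

  ·≡⇒≤ : ∀ {x y} → x · y ≡ x → x ≤ y
  ·≡⇒≤ {x} {y} = Equivalence.from (≤⇔· x y)

  ·-monoˡ-≤ : ∀ {a b} x → a ≤ b → a · x ≤ b · x
  ·-monoˡ-≤ {a} {b} x a≤b = ·≡⇒≤ (begin
    a · x · (b · x)    ≡⟨ assoc a x (b · x) ⟩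
    a · (x · (b · x))  ≡⟨ cong (a ·_) (sym (assoc x b x)) ⟩
    a · (x · b · x)    ≡⟨ cong (a ·_) (rightRegular x b) ⟩
    a · (b · x)        ≡⟨ sym (assoc a b x) ⟩
    a · b · x          ≡⟨ cong (_· x) (≤⇒·≡ a≤b) ⟩
    a · x              ∎)

  ·-glb : ∀ {c x y} → c ≤ x → c ≤ y → c ≤ x · y
  ·-glb {c} {x} {y} c≤x c≤y = ·≡⇒≤ (begin
    c · (x · y)  ≡⟨ sym (assoc c x y) ⟩
    c · x · y    ≡⟨ cong (_· y) (≤⇒·≡ c≤x) ⟩
    c · y        ≡⟨ ≤⇒·≡ c≤y ⟩
    c            ∎)

  x·y≤y : ∀ x y → x · y ≤ y
  x·y≤y x y = ·≡⇒≤ (trans (assoc x y y) (cong (x ·_) (idem y)))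

  x·y≤x : ∀ {x y} → x · y ≡ y · x → x · y ≤ x
  x·y≤x {x} {y} comm = ·≡⇒≤ (trans (rightRegular x y) (sym comm))

  ·-isInfimum : ∀ {x y} → x · y ≡ y · x → IsInfimum _≤_ x y (x · y)
  ·-isInfimum {x} {y} comm = (x·y≤x comm , x·y≤y x y) , λ _ → ·-glb

lemma2p5 : ∀ {c ℓ} (P : RightPosemigroup c ℓ) →
    let open RightPosemigroup P in
    (∀ a b x → a ≤ b → a · x ≤ b · x)
    × (∀ c x y → c ≤ x → c ≤ y → (c ≤ x · y × c ≤ y · x))
    × (∀ x y → x · y ≡ y · x → IsInfimum _≤_ x y (x · y))
lemma2p5 P =
    (λ _ _ x → ·-monoˡ-≤ x)
  , (λ _ _ _ c≤x c≤y → ·-glb c≤x c≤y , ·-glb c≤y c≤x)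
  , (λ _ _ → ·-isInfimum)
  where open RightPosemigroupProperties P
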